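{- There exist constants $k_0$ and $t_0$ such that the following holds. Let $n,t,q,k$ be integers with $n^{0.99}<t\le q\le n$, $t>t_0$, and $k_0<k\le q-t$. Let $f(j)=\binom tj\binom kj^2k^{k-j}$ and let $j_0\in[0,\min(t,k)]$ be an index at which $f$ attains its maximum over integers in $[0,\min(t,k)]$. (a) If $k=o(t^{1/4})$ (i.e., along parameters with $k/t^{1/4}\to0$), then $j_0=k$ for all sufficiently large $t$. (b) If $k\le t^{1/2}$, then $j_0\ge\frac12k$. (c) If $k\ge t^{1/2}$, then $j_0\ge\frac12(tk)^{1/3}$.
   Context: Here $q$ is the uniformity bound of a $t$-intersecting family $\mathcal S$ of subsets of $[n]^2$ of size at most $q$ to which a peeling construction is applied; only the inequality $k\le q-t$ matters for the statement. -}

module Defs where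

open import Data.Nat using (ℕ; _+_; _*_; _∸_; _^_; _≤_; _<_; _⊔_; _⊓_)
open import Data.Nat.Combinatorics using (_C_)
open import Data.Product using (_×_)

f : ℕ → ℕ → ℕ → ℕ
f t k j = (t C j) * ((k C j) * (k C j)) * (k ^ (k ∸ j))

IsMaxIndex : ℕ → ℕ → ℕ → Set
IsMaxIndex t k j0 = (j0 ≤ t ⊓ k) × (∀ j → j ≤ t ⊓ k → f t k j ≤ f t k j0)

-- Standing hypotheses (given the constants k0, t0):
-- n^0.99 < t  (encoded as n^99 < t^100), t ≤ q ≤ n, t > t0, k0 < k ≤ q - t.
Hyp : ℕ → ℕ → ℕ → ℕ → ℕ → ℕ → Set
Hyp k0 t0 n t q k =
  (n ^ 99 < t ^ 100) × (t ≤ q) × (q ≤ n) × (t0 < t) × (k0 < k) × (k + t ≤ q)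

{-# OPTIONS --safe #-}
-- Consecutive terms of f satisfy f(j+1)/f(j) = (t−j)(k−j)² / (k(j+1)³), so at a maximising
-- index j < min(t,k) we must have (t−j)(k−j)² ≤ k(j+1)³.  Each part shows that this fails
-- below the claimed bound: in (a) k(j+1)³ ≤ k⁴ is negligible against t − j; in (b)
-- k(j+1) < t − j and j+1 ≤ k − j; in (c) one gets 2j < k and 3j < t (the latter from
-- 4k < t², a consequence of n^0.99 < t), whence (t−j)(k−j)² ≥ tk²/6 > k(j+1)³.
module Submission where

open import Defs
open import Data.Nat
open import Data.Nat.Properties
open import Data.Nat.Combinatorics
open import Data.Nat.Solver using (module +-*-Solver)
open import Data.Product using (_×_; ∃; ∃-syntax; _,_; proj₂)
open import Data.Sum using (inj₁; inj₂)
open import Relation.Nullary using (yes; no; contradiction)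
open import Relation.Binary.PropositionalEquality
open +-*-Solver

private
  variable
    n k t j : ℕ

nCk>0 : k ≤ n → 0 < n C k
nCk>0 {zero}  {n}     _         = s≤s z≤n
nCk>0 {suc k} {suc n} (s≤s k≤n) =
  subst (0 <_) (nCk+nC[k+1]≡[n+1]C[k+1] n k) (≤-trans (nCk>0 k≤n) (m≤m+n (n C k) (n C suc k)))

[1+k]*nC[1+k]+k*nCk≡n*nCk : ∀ n k → suc k * (n C suc k) + k * (n C k) ≡ n * (n C k)
[1+k]*nC[1+k]+k*nCk≡n*nCk zero    zero    = refl
[1+k]*nC[1+k]+k*nCk≡n*nCk zero    (suc k) = cong₂ _+_ (*-zeroʳ (suc (suc k))) (*-zeroʳ (suc k))
[1+k]*nC[1+k]+k*nCk≡n*nCk (suc n) zero    = begin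
  1 * (suc n C 1) + 0 ≡⟨ solve 1 (λ x → con 1 :* x :+ con 0 := x :* con 1) refl (suc n C 1) ⟩
  (suc n C 1) * 1     ≡⟨ cong (_* 1) (nC1≡n (suc n)) ⟩
  suc n * 1           ∎
  where open ≡-Reasoning
[1+k]*nC[1+k]+k*nCk≡n*nCk (suc n) (suc k) = begin
  suc (suc k) * (suc n C suc (suc k)) + suc k * (suc n C suc k)
    ≡⟨ cong₂ (λ a b → suc (suc k) * a + suc k * b)
         (sym (nCk+nC[k+1]≡[n+1]C[k+1] n (suc k))) (sym (nCk+nC[k+1]≡[n+1]C[k+1] n k)) ⟩
  suc (suc k) * (c₁ + c₂) + suc k * (c₀ + c₁)
    ≡⟨ solve 4 (λ k c₀ c₁ c₂ → (con 2 :+ k) :* (c₁ :+ c₂) :+ (con 1 :+ k) :* (c₀ :+ c₁)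
                 := (c₁ :+ c₀) :+ ((con 2 :+ k) :* c₂ :+ (con 1 :+ k) :* c₁) :+ ((con 1 :+ k) :* c₁ :+ k :* c₀))
         refl k c₀ c₁ c₂ ⟩
  (c₁ + c₀) + (suc (suc k) * c₂ + suc k * c₁) + (suc k * c₁ + k * c₀)
    ≡⟨ cong₂ (λ a b → (c₁ + c₀) + a + b) ([1+k]*nC[1+k]+k*nCk≡n*nCk n (suc k)) ([1+k]*nC[1+k]+k*nCk≡n*nCk n k) ⟩
  (c₁ + c₀) + n * c₁ + n * c₀
    ≡⟨ solve 3 (λ n c₀ c₁ → (c₁ :+ c₀) :+ n :* c₁ :+ n :* c₀ := (con 1 :+ n) :* (c₀ :+ c₁)) refl n c₀ c₁ ⟩
  suc n * (c₀ + c₁)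
    ≡⟨ cong (suc n *_) (nCk+nC[k+1]≡[n+1]C[k+1] n k) ⟩
  suc n * (suc n C suc k) ∎
  where
  open ≡-Reasoning
  c₀ = n C k
  c₁ = n C suc k
  c₂ = n C suc (suc k)

[1+k]*nC[1+k]≡[n∸k]*nCk : k ≤ n → suc k * (n C suc k) ≡ (n ∸ k) * (n C k)
[1+k]*nC[1+k]≡[n∸k]*nCk {k} {n} k≤n = +-cancelʳ-≡ (k * (n C k)) _ _ (begin
  suc k * (n C suc k) + k * (n C k) ≡⟨ [1+k]*nC[1+k]+k*nCk≡n*nCk n k ⟩
  n * (n C k)                       ≡⟨ cong (_* (n C k)) (m∸n+n≡m k≤n) ⟨
  (n ∸ k + k) * (n C k)             ≡⟨ *-distribʳ-+ (n C k) (n ∸ k) k ⟩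
  (n ∸ k) * (n C k) + k * (n C k)   ∎)
  where open ≡-Reasoning

^-distribʳ-* : ∀ m n o → (m * n) ^ o ≡ m ^ o * n ^ o
^-distribʳ-* m n zero    = refl
^-distribʳ-* m n (suc o) = begin
  (m * n) * (m * n) ^ o     ≡⟨ cong ((m * n) *_) (^-distribʳ-* m n o) ⟩
  (m * n) * (m ^ o * n ^ o) ≡⟨ solve 4 (λ m n x y → (m :* n) :* (x :* y) := (m :* x) :* (n :* y)) refl m n (m ^ o) (n ^ o) ⟩
  (m * m ^ o) * (n * n ^ o) ∎
  where open ≡-Reasoning

maxBelow : (ℕ → ℕ) → ℕ → ℕ
maxBelow g zero    = 0
maxBelow g (suc N) = g N ⊔ maxBelow g N

i<N⇒g[i]≤maxBelow[g,N] : ∀ g {i N} → i < N → g i ≤ maxBelow g N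
i<N⇒g[i]≤maxBelow[g,N] g {i} {suc N} i<1+N with m<1+n⇒m<n∨m≡n i<1+N
... | inj₁ i<N  = ≤-trans (i<N⇒g[i]≤maxBelow[g,N] g i<N) (m≤n⊔m (g N) (maxBelow g N))
... | inj₂ refl = m≤m⊔n (g N) (maxBelow g N)

index-threshold⇒value-threshold : ∀ (g : ℕ → ℕ) {N} {P : ℕ → Set} →
  (∀ i → i ≥ N → P i) → ∃[ T ] (∀ i → g i ≥ T → P i)
index-threshold⇒value-threshold g {N} P-beyond-N = suc (maxBelow g N) , λ i g[i]>max →
  P-beyond-N i (≮⇒≥ λ i<N → <⇒≱ g[i]>max (i<N⇒g[i]≤maxBelow[g,N] g i<N))

f-step : j < k → j ≤ t → f t k (suc j) * (suc j ^ 3 * k) ≡ f t k j * ((t ∸ j) * (k ∸ j) ^ 2)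
f-step {j} {k} {t} j<k j≤t = begin
  (a′ * (b′ * b′) * k ^ (k ∸ suc j)) * (suc j ^ 3 * k)
    ≡⟨ solve 5 (λ a′ b′ p s k → (a′ :* (b′ :* b′) :* p) :* (s :^ 3 :* k)
                 := (s :* a′) :* ((s :* b′) :* (s :* b′)) :* (k :* p)) refl a′ b′ (k ^ (k ∸ suc j)) (suc j) k ⟩
  (suc j * a′) * ((suc j * b′) * (suc j * b′)) * k ^ suc (k ∸ suc j)
    ≡⟨ cong₂ (λ a b → a * (b * b) * k ^ suc (k ∸ suc j))
         ([1+k]*nC[1+k]≡[n∸k]*nCk j≤t) ([1+k]*nC[1+k]≡[n∸k]*nCk (<⇒≤ j<k)) ⟩
  ((t ∸ j) * a) * (((k ∸ j) * b) * ((k ∸ j) * b)) * k ^ suc (k ∸ suc j)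
    ≡⟨ cong (λ e → ((t ∸ j) * a) * (((k ∸ j) * b) * ((k ∸ j) * b)) * k ^ e) (+-∸-assoc 1 j<k) ⟨
  ((t ∸ j) * a) * (((k ∸ j) * b) * ((k ∸ j) * b)) * k ^ (k ∸ j)
    ≡⟨ solve 5 (λ u v a b p → (u :* a) :* ((v :* b) :* (v :* b)) :* p := (a :* (b :* b) :* p) :* (u :* v :^ 2))
         refl (t ∸ j) (k ∸ j) a b (k ^ (k ∸ j)) ⟩
  f t k j * ((t ∸ j) * (k ∸ j) ^ 2) ∎
  where
  open ≡-Reasoning
  a = t C j
  a′ = t C suc j
  b = k C j
  b′ = k C suc j

k^[k∸j]>0 : j ≤ k → 0 < k ^ (k ∸ j)
k^[k∸j]>0 {k = zero}  z≤n = s≤s z≤n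
k^[k∸j]>0 {j} {suc k} _   = m^n>0 (suc k) (suc k ∸ j)

f>0 : j ≤ t → j ≤ k → 0 < f t k j
f>0 j≤t j≤k = *-mono-≤ (*-mono-≤ (nCk>0 j≤t) (*-mono-≤ (nCk>0 j≤k) (nCk>0 j≤k))) (k^[k∸j]>0 j≤k)

f-increasing : j < k → j < t → k * suc j ^ 3 < (t ∸ j) * (k ∸ j) ^ 2 → f t k j < f t k (suc j)
f-increasing {j} {k} {t} j<k j<t ratio>1 = *-cancelʳ-< (suc j ^ 3 * k) _ _ (begin-strict
  f t k j * (suc j ^ 3 * k)          ≡⟨ cong (f t k j *_) (*-comm (suc j ^ 3) k) ⟩
  f t k j * (k * suc j ^ 3)          <⟨ *-monoʳ-< (f t k j) {{>-nonZero (f>0 (<⇒≤ j<t) (<⇒≤ j<k))}} ratio>1 ⟩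
  f t k j * ((t ∸ j) * (k ∸ j) ^ 2)  ≡⟨ f-step j<k (<⇒≤ j<t) ⟨
  f t k (suc j) * (suc j ^ 3 * k)    ∎)
  where open ≤-Reasoning

IsMaxIndex⇒[t∸j][k∸j]²≤k[1+j]³ : IsMaxIndex t k j → j < k → j < t → (t ∸ j) * (k ∸ j) ^ 2 ≤ k * suc j ^ 3
IsMaxIndex⇒[t∸j][k∸j]²≤k[1+j]³ (_ , maximal) j<k j<t = ≮⇒≥ λ ratio>1 →
  <⇒≱ (f-increasing j<k j<t ratio>1) (maximal _ (⊓-glb j<t j<k))

IsMaxIndex⇒j≤k : IsMaxIndex t k j → j ≤ k
IsMaxIndex⇒j≤k {t} {k} (j≤t⊓k , _) = ≤-trans j≤t⊓k (m⊓n≤n t k)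

IsMaxIndex∧16k⁴<t⇒j≡k : IsMaxIndex t k j → 16 * k ^ 4 < t → j ≡ k
IsMaxIndex∧16k⁴<t⇒j≡k {t} {k} {j} max 16k⁴<t with m≤n⇒m<n∨m≡n (IsMaxIndex⇒j≤k max)
... | inj₂ j≡k = j≡k
... | inj₁ j<k = contradiction (IsMaxIndex⇒[t∸j][k∸j]²≤k[1+j]³ max j<k j<t) (<⇒≱ ratio>1)
  where
  open ≤-Reasoning
  instance
    _ : NonZero k
    _ = >-nonZero (m<n⇒0<n j<k)
    _ : NonZero (k ∸ j)
    _ = >-nonZero (m<n⇒0<n∸m j<k)
  k⁴+k<t : k ^ 4 + k < t
  k⁴+k<t = begin-strict
    k ^ 4 + k      ≤⟨ +-monoʳ-≤ (k ^ 4) (m≤m*n k (k ^ 3) {{m^n≢0 k 3}}) ⟩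
    k ^ 4 + k ^ 4  ≤⟨ +-monoʳ-≤ (k ^ 4) (m≤m+n (k ^ 4) _) ⟩
    2 * k ^ 4      ≤⟨ *-monoˡ-≤ (k ^ 4) {2} {16} (s≤s (s≤s z≤n)) ⟩
    16 * k ^ 4     <⟨ 16k⁴<t ⟩
    t              ∎
  j<t : j < t
  j<t = <-≤-trans j<k (≤-trans (m≤n+m k (k ^ 4)) (<⇒≤ k⁴+k<t))
  ratio>1 : k * suc j ^ 3 < (t ∸ j) * (k ∸ j) ^ 2
  ratio>1 = begin-strict
    k * suc j ^ 3            ≤⟨ *-monoʳ-≤ k (^-monoˡ-≤ 3 j<k) ⟩
    k ^ 4                    <⟨ m+n≤o⇒m≤o∸n (suc (k ^ 4)) k⁴+k<t ⟩
    t ∸ k                    ≤⟨ ∸-monoʳ-≤ t (<⇒≤ j<k) ⟩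
    t ∸ j                    ≤⟨ m≤m*n (t ∸ j) ((k ∸ j) ^ 2) {{m^n≢0 (k ∸ j) 2}} ⟩
    (t ∸ j) * (k ∸ j) ^ 2    ∎

eventually-j₀≡k : ∀ (t k j₀ : ℕ → ℕ) {N} → (∀ i → IsMaxIndex (t i) (k i) (j₀ i)) →
  (∀ i → i ≥ N → 16 * k i ^ 4 < t i) → ∃[ T ] (∀ i → t i ≥ T → j₀ i ≡ k i)
eventually-j₀≡k t k j₀ max 16k⁴<t =
  index-threshold⇒value-threshold t λ i i≥N → IsMaxIndex∧16k⁴<t⇒j≡k (max i) (16k⁴<t i i≥N)

k[1+j]+j<k² : 1 < k → 2 * j < k → k * suc j + j < k * k
k[1+j]+j<k² {k} {zero}  1<k _    = begin-strict
  k * 1 + 0  ≡⟨ solve 1 (λ k → k :* con 1 :+ con 0 := k) refl k ⟩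
  k          <⟨ m<m*n k k {{>-nonZero (<-trans (s≤s z≤n) 1<k)}} 1<k ⟩
  k * k      ∎
  where open ≤-Reasoning
k[1+j]+j<k² {k} {suc j} 1<k 2j<k = begin-strict
  k * suc (suc j) + suc j        <⟨ +-monoʳ-< (k * suc (suc j)) (m<m*n (suc j) k 1<k) ⟩
  k * suc (suc j) + suc j * k    ≡⟨ cong (k * suc (suc j) +_) (*-comm (suc j) k) ⟩
  k * suc (suc j) + k * suc j    ≡⟨ solve 2 (λ k j → k :* (con 2 :+ j) :+ k :* (con 1 :+ j)
                                                := k :* (con 1 :+ con 2 :* (con 1 :+ j))) refl k j ⟩
  k * suc (2 * suc j)            ≤⟨ *-monoʳ-≤ k 2j<k ⟩
  k * k                          ∎
  where open ≤-Reasoning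

IsMaxIndex∧k²≤t⇒k≤2j : IsMaxIndex t k j → 1 < k → k * k ≤ t → k ≤ 2 * j
IsMaxIndex∧k²≤t⇒k≤2j {t} {k} {j} max 1<k k²≤t with k ≤? 2 * j
... | yes k≤2j = k≤2j
... | no  k≰2j = contradiction (IsMaxIndex⇒[t∸j][k∸j]²≤k[1+j]³ max j<k j<t) (<⇒≱ ratio>1)
  where
  open ≤-Reasoning
  2j<k : 2 * j < k
  2j<k = ≰⇒> k≰2j
  j<k : j < k
  j<k = ≤-trans (s≤s (m≤m+n j _)) 2j<k
  j<t : j < t
  j<t = <-≤-trans j<k (≤-trans (m≤m*n k k {{>-nonZero (m<n⇒0<n j<k)}}) k²≤t)
  k[1+j]<t∸j : k * suc j < t ∸ j
  k[1+j]<t∸j = m+n≤o⇒m≤o∸n (suc (k * suc j)) (≤-trans (k[1+j]+j<k² 1<k 2j<k) k²≤t)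
  1+j≤k∸j : suc j ≤ k ∸ j
  1+j≤k∸j = m+n≤o⇒m≤o∸n (suc j) (subst (λ i → suc (j + i) ≤ k) (+-identityʳ j) 2j<k)
  ratio>1 : k * suc j ^ 3 < (t ∸ j) * (k ∸ j) ^ 2
  ratio>1 = begin-strict
    k * suc j ^ 3          ≡⟨ solve 2 (λ k s → k :* s :^ 3 := (k :* s) :* s :^ 2) refl k (suc j) ⟩
    (k * suc j) * suc j ^ 2 <⟨ *-monoˡ-< (suc j ^ 2) k[1+j]<t∸j ⟩
    (t ∸ j) * suc j ^ 2    ≤⟨ *-monoʳ-≤ (t ∸ j) (^-monoˡ-≤ 2 1+j≤k∸j) ⟩
    (t ∸ j) * (k ∸ j) ^ 2  ∎

16≤t∧n⁹⁹<t¹⁰⁰⇒4n<t² : 16 ≤ t → n ^ 99 < t ^ 100 → 4 * n < t * t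
16≤t∧n⁹⁹<t¹⁰⁰⇒4n<t² {t} {n} 16≤t n⁹⁹<t¹⁰⁰ = ≰⇒> λ t²≤4n → <⇒≱ (t⁹⁸<4⁹⁹ t²≤4n) 4⁹⁹≤t⁹⁸
  where
  open ≤-Reasoning
  instance
    _ : NonZero t
    _ = >-nonZero (<-≤-trans (s≤s z≤n) 16≤t)
  t⁹⁸<4⁹⁹ : t * t ≤ 4 * n → t ^ 98 < 4 ^ 99
  t⁹⁸<4⁹⁹ t²≤4n = *-cancelʳ-< (t ^ 100) (t ^ 98) (4 ^ 99) (begin-strict
    t ^ 98 * t ^ 100    ≡⟨ ^-distribˡ-+-* t 98 100 ⟨
    t ^ (99 + 99)       ≡⟨ ^-distribˡ-+-* t 99 99 ⟩
    t ^ 99 * t ^ 99     ≡⟨ ^-distribʳ-* t t 99 ⟨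
    (t * t) ^ 99        ≤⟨ ^-monoˡ-≤ 99 t²≤4n ⟩
    (4 * n) ^ 99        ≡⟨ ^-distribʳ-* 4 n 99 ⟩
    4 ^ 99 * n ^ 99     <⟨ *-monoʳ-< (4 ^ 99) n⁹⁹<t¹⁰⁰ ⟩
    4 ^ 99 * t ^ 100    ∎)
  4⁹⁹≤t⁹⁸ : 4 ^ 99 ≤ t ^ 98
  4⁹⁹≤t⁹⁸ = begin
    4 ^ 99   ≤⟨ ^-monoʳ-≤ 4 {99} {196} (m≤m+n 99 97) ⟩
    16 ^ 98  ≤⟨ ^-monoˡ-≤ 98 16≤t ⟩
    t ^ 98   ∎

Hyp⇒4k<t² : ∀ {k₀ t₀ n q} → 15 ≤ t₀ → Hyp k₀ t₀ n t q k → 4 * k < t * t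
Hyp⇒4k<t² {t = t} {k = k} {n = n} 15≤t₀ (n⁹⁹<t¹⁰⁰ , _ , q≤n , t₀<t , _ , k+t≤q) =
  ≤-<-trans (*-monoʳ-≤ 4 k≤n) (16≤t∧n⁹⁹<t¹⁰⁰⇒4n<t² {n = n} (≤-<-trans 15≤t₀ t₀<t) n⁹⁹<t¹⁰⁰)
  where
  k≤n : k ≤ n
  k≤n = ≤-trans (m≤m+n k t) (≤-trans k+t≤q q≤n)

[1+a]j≤t⇒at≤[1+a][t∸j] : ∀ a → suc a * j ≤ t → a * t ≤ suc a * (t ∸ j)
[1+a]j≤t⇒at≤[1+a][t∸j] {j} {t} a [1+a]j≤t = +-cancelʳ-≤ (suc a * j) (a * t) (suc a * (t ∸ j)) (begin
  a * t + suc a * j          ≤⟨ +-monoʳ-≤ (a * t) [1+a]j≤t ⟩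
  a * t + t                  ≡⟨ +-comm (a * t) t ⟩
  suc a * t                  ≡⟨ cong (suc a *_) (m∸n+n≡m j≤t) ⟨
  suc a * (t ∸ j + j)        ≡⟨ *-distribˡ-+ (suc a) (t ∸ j) j ⟩
  suc a * (t ∸ j) + suc a * j ∎)
  where
  open ≤-Reasoning
  j≤t : j ≤ t
  j≤t = ≤-trans (m≤m+n j (a * j)) [1+a]j≤t

3j≤t∧2j≤k⇒2tk²≤12[t∸j][k∸j]² : 3 * j ≤ t → 2 * j ≤ k → 2 * (t * k ^ 2) ≤ 12 * ((t ∸ j) * (k ∸ j) ^ 2)
3j≤t∧2j≤k⇒2tk²≤12[t∸j][k∸j]² {j} {t} {k} 3j≤t 2j≤k = begin
  2 * (t * k ^ 2)                  ≡⟨ solve 2 (λ t k → con 2 :* (t :* k :^ 2) := (con 2 :* t) :* k :^ 2) refl t k ⟩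
  (2 * t) * k ^ 2                  ≤⟨ *-mono-≤ ([1+a]j≤t⇒at≤[1+a][t∸j] {j} 2 3j≤t) (^-monoˡ-≤ 2 k≤2[k∸j]) ⟩
  (3 * (t ∸ j)) * (2 * (k ∸ j)) ^ 2 ≡⟨ solve 2 (λ u v → (con 3 :* u) :* (con 2 :* v) :^ 2 := con 12 :* (u :* v :^ 2))
                                        refl (t ∸ j) (k ∸ j) ⟩
  12 * ((t ∸ j) * (k ∸ j) ^ 2)     ∎
  where
  open ≤-Reasoning
  k≤2[k∸j] : k ≤ 2 * (k ∸ j)
  k≤2[k∸j] = subst (_≤ 2 * (k ∸ j)) (+-identityʳ k) ([1+a]j≤t⇒at≤[1+a][t∸j] {j} 1 2j≤k)

t≤k²∧[2j]³<tk⇒2j<k : t ≤ k * k → (2 * j) ^ 3 < t * k → 2 * j < k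
t≤k²∧[2j]³<tk⇒2j<k {t} {k} {j} t≤k² [2j]³<tk = ≰⇒> λ k≤2j → <⇒≱ [2j]³<tk (begin
  t * k       ≤⟨ *-monoˡ-≤ k t≤k² ⟩
  k * k * k   ≡⟨ solve 1 (λ k → k :* k :* k := k :^ 3) refl k ⟩
  k ^ 3       ≤⟨ ^-monoˡ-≤ 3 k≤2j ⟩
  (2 * j) ^ 3 ∎)
  where open ≤-Reasoning

4k<t²∧[2j]³<tk⇒3j<t : 4 * k < t * t → (2 * j) ^ 3 < t * k → 3 * j < t
4k<t²∧[2j]³<tk⇒3j<t {k} {t} {j} 4k<t² [2j]³<tk = ≰⇒> λ t≤3j → <⇒≱ 4k<t² (<⇒≤ (t²<4k t≤3j))
  where
  open ≤-Reasoning
  t²<4k : t ≤ 3 * j → t * t < 4 * k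
  t²<4k t≤3j = *-cancelˡ-< 8 (t * t) (4 * k) (begin-strict
    8 * (t * t)  <⟨ *-cancelˡ-< t (8 * (t * t)) (27 * k) (begin-strict
      t * (8 * (t * t))  ≡⟨ solve 1 (λ t → t :* (con 8 :* (t :* t)) := con 8 :* t :^ 3) refl t ⟩
      8 * t ^ 3          ≤⟨ *-monoʳ-≤ 8 (^-monoˡ-≤ 3 t≤3j) ⟩
      8 * (3 * j) ^ 3    ≡⟨ solve 1 (λ j → con 8 :* (con 3 :* j) :^ 3 := con 27 :* (con 2 :* j) :^ 3) refl j ⟩
      27 * (2 * j) ^ 3   <⟨ *-monoʳ-< 27 [2j]³<tk ⟩
      27 * (t * k)       ≡⟨ solve 2 (λ t k → con 27 :* (t :* k) := t :* (con 27 :* k)) refl t k ⟩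
      t * (27 * k)       ∎) ⟩
    27 * k       ≤⟨ *-monoˡ-≤ k {27} {32} (m≤m+n 27 5) ⟩
    32 * k       ≡⟨ *-assoc 8 4 k ⟩
    8 * (4 * k)  ∎)

-- 6 · (11/10)³ < 8 settles j ≥ 10; for j ≤ 9 the bound 6 · 10³ < t suffices.
6[1+j]³<tk : 6000 < t → 0 < k → (2 * j) ^ 3 < t * k → 6 * suc j ^ 3 < t * k
6[1+j]³<tk {t} {k} {j} 6000<t 0<k [2j]³<tk with j ≤? 9
... | yes j≤9 = begin-strict
  6 * suc j ^ 3  ≤⟨ *-monoʳ-≤ 6 (^-monoˡ-≤ 3 (s≤s j≤9)) ⟩
  6000           <⟨ 6000<t ⟩
  t              ≤⟨ m≤m*n t k {{>-nonZero 0<k}} ⟩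
  t * k          ∎
  where open ≤-Reasoning
... | no j≰9 = *-cancelˡ-< 1000 (6 * suc j ^ 3) (t * k) (begin-strict
  1000 * (6 * suc j ^ 3) ≡⟨ solve 1 (λ j → con 1000 :* (con 6 :* (con 1 :+ j) :^ 3)
                                          := con 6 :* (con 10 :* (con 1 :+ j)) :^ 3) refl j ⟩
  6 * (10 * suc j) ^ 3   ≤⟨ *-monoʳ-≤ 6 (^-monoˡ-≤ 3 10[1+j]≤11j) ⟩
  6 * (11 * j) ^ 3       ≡⟨ solve 1 (λ j → con 6 :* (con 11 :* j) :^ 3 := con 7986 :* j :^ 3) refl j ⟩
  7986 * j ^ 3           ≤⟨ *-monoˡ-≤ (j ^ 3) {7986} {8000} (m≤m+n 7986 14) ⟩
  8000 * j ^ 3           ≡⟨ solve 1 (λ j → con 8000 :* j :^ 3 := con 1000 :* (con 2 :* j) :^ 3) refl j ⟩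
  1000 * (2 * j) ^ 3     <⟨ *-monoʳ-< 1000 [2j]³<tk ⟩
  1000 * (t * k)         ∎)
  where
  open ≤-Reasoning
  10[1+j]≤11j : 10 * suc j ≤ 11 * j
  10[1+j]≤11j = begin
    10 * suc j  ≡⟨ *-suc 10 j ⟩
    10 + 10 * j ≤⟨ +-monoˡ-≤ (10 * j) (≰⇒> j≰9) ⟩
    j + 10 * j  ∎

IsMaxIndex∧t≤k²⇒tk≤[2j]³ : IsMaxIndex t k j → 6000 < t → 4 * k < t * t → t ≤ k * k → t * k ≤ (2 * j) ^ 3
IsMaxIndex∧t≤k²⇒tk≤[2j]³ {t} {k} {j} max 6000<t 4k<t² t≤k² with t * k ≤? (2 * j) ^ 3
... | yes tk≤[2j]³ = tk≤[2j]³
... | no  tk≰[2j]³ = contradiction (IsMaxIndex⇒[t∸j][k∸j]²≤k[1+j]³ max j<k j<t) (<⇒≱ ratio>1)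
  where
  open ≤-Reasoning
  [2j]³<tk : (2 * j) ^ 3 < t * k
  [2j]³<tk = ≰⇒> tk≰[2j]³
  2j<k : 2 * j < k
  2j<k = t≤k²∧[2j]³<tk⇒2j<k {j = j} t≤k² [2j]³<tk
  3j<t : 3 * j < t
  3j<t = 4k<t²∧[2j]³<tk⇒3j<t {j = j} 4k<t² [2j]³<tk
  j<k : j < k
  j<k = ≤-trans (s≤s (m≤m+n j _)) 2j<k
  j<t : j < t
  j<t = ≤-trans (s≤s (m≤m+n j _)) 3j<t
  instance
    _ : NonZero (2 * k)
    _ = m*n≢0 2 k {{_}} {{>-nonZero (m<n⇒0<n j<k)}}
  ratio>1 : k * suc j ^ 3 < (t ∸ j) * (k ∸ j) ^ 2
  ratio>1 = *-cancelˡ-< 12 (k * suc j ^ 3) ((t ∸ j) * (k ∸ j) ^ 2) (begin-strict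
    12 * (k * suc j ^ 3)           ≡⟨ solve 2 (λ k s → con 12 :* (k :* s :^ 3) := (con 2 :* k) :* (con 6 :* s :^ 3))
                                          refl k (suc j) ⟩
    (2 * k) * (6 * suc j ^ 3)      <⟨ *-monoʳ-< (2 * k) (6[1+j]³<tk {j = j} 6000<t (m<n⇒0<n j<k) [2j]³<tk) ⟩
    (2 * k) * (t * k)              ≡⟨ solve 2 (λ t k → (con 2 :* k) :* (t :* k) := con 2 :* (t :* k :^ 2)) refl t k ⟩
    2 * (t * k ^ 2)                ≤⟨ 3j≤t∧2j≤k⇒2tk²≤12[t∸j][k∸j]² {j = j} (<⇒≤ 3j<t) (<⇒≤ 2j<k) ⟩
    12 * ((t ∸ j) * (k ∸ j) ^ 2)   ∎)

proposition4p4 :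
    ∃[ k0 ] ∃[ t0 ]
      -- (a) along any sequence of parameters with k/t^(1/4) → 0
      -- (i.e. for every m ≥ 1 eventually m^4 k^4 < t), eventually j0 = k
      ( ( (n t q k j0 : ℕ → ℕ)
          → (∀ i → Hyp k0 t0 (n i) (t i) (q i) (k i))
          → (∀ i → IsMaxIndex (t i) (k i) (j0 i))
          → (∀ m → 1 ≤ m → ∃[ N ] (∀ i → i ≥ N → (m ^ 4) * (k i ^ 4) < t i))
          → ∃[ T ] (∀ i → t i ≥ T → j0 i ≡ k i) )
      × -- (b) k ≤ t^(1/2) ⇒ j0 ≥ k/2
        ( ∀ n t q k j0 → Hyp k0 t0 n t q k → IsMaxIndex t k j0
          → k * k ≤ t → k ≤ 2 * j0 )
      × -- (c) k ≥ t^(1/2) ⇒ j0 ≥ (tk)^(1/3)/2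
        ( ∀ n t q k j0 → Hyp k0 t0 n t q k → IsMaxIndex t k j0
          → t ≤ k * k → t * k ≤ (2 * j0) ^ 3 ) )
proposition4p4 =
  1 , 6000
  , (λ _ t _ k j₀ _ max k/t¼→0 → eventually-j₀≡k t k j₀ max (proj₂ (k/t¼→0 2 (s≤s z≤n))))
  , (λ { _ _ _ _ _ (_ , _ , _ , _ , 1<k , _) max k²≤t → IsMaxIndex∧k²≤t⇒k≤2j max 1<k k²≤t })
  , (λ { _ _ _ _ _ hyp@(_ , _ , _ , 6000<t , _) max t≤k² →
         IsMaxIndex∧t≤k²⇒tk≤[2j]³ max 6000<t (Hyp⇒4k<t² (m≤m+n 15 5985) hyp) t≤k² })
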